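{- Let $F_1,\ldots,F_r$ be functions from the class of (finite simple undirected) graphs to $\mathbb{N}$. Suppose that for all graphs $G$ and $H$ and every module $M$ of $G$, if $F_i(G[M])=F_i(H)$ for all $i\in[r]$, then $F_i(G)=F_i(G')$ for all $i\in[r]$, where $G'$ is obtained from $G$ by replacing $G[M]$ with $H$. Then for any graph $G$ and any modular partition $P$ of $V(G)$, the quotient graph $G_{/P}$ together with the values $F_1(G[M]),\ldots,F_r(G[M])$ for all $M\in P$ completely determine $F_1(G),\ldots,F_r(G)$; that is, if $G_1,G_2$ are graphs with modular partitions $P_1,P_2$ and there is an isomorphism $\varphi$ from $G_{1/P_1}$ to $G_{2/P_2}$ such that $F_i(G_1[M_1])=F_i(G_2[M_2])$ for all $i$ whenever $\varphi(v_{M_1})=v_{M_2}$, then $F_i(G_1)=F_i(G_2)$ for all $i\in[r]$.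
   Context: A module of a graph $G=(V,E)$ is a set $M\subseteq V$ such that every $v\in V\setminus M$ is adjacent either to all vertices of $M$ or to none. A modular partition of $V$ is a partition $P$ of $V$ into nonempty modules. The quotient graph $G_{/P}$ has one vertex $v_M$ per $M\in P$, with $v_Mv_{M'}$ an edge iff every vertex of $M$ is adjacent to every vertex of $M'$. Modular replacement: given graphs $G=(V,E)$ and $H=(V_H,E_H)$ with $V\cap V_H=\emptyset$ and a module $M$ of $G$, the graph $G'$ obtained from $G$ by replacing $G[M]$ with $H$ has vertex set $(V\setminus M)\cup V_H$ and edge set consisting of the edges of $G$ with both ends in $V\setminus M$, the edges of $H$, and all edges $uv$ with $u\in V_H$ and $v\in N(M)$, where $N(M)$ is the set of vertices outside $M$ adjacent to some vertex of $M$. -}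

module Defs where

open import Data.Bool using (Bool; true; false; T; not; _∧_; _∨_; if_then_else_)
open import Data.Bool.Properties using (T?; T-irrelevant)
open import Data.Nat using (ℕ)
open import Data.Fin using (Fin)
import Data.Fin as Fin
open import Data.List using (List; []; _∷_; _++_; map)
open import Data.Bool.ListAction using (any)
open import Data.List.Membership.Propositional using (_∈_)
open import Data.List.Relation.Unary.Any using (here; there)
open import Data.List.Membership.Propositional.Properties using (∈-++⁺ˡ; ∈-++⁺ʳ; ∈-map⁺)
open import Data.Product using (Σ; Σ-syntax; ∃; ∃-syntax; _,_; proj₁; proj₂; _×_)
open import Data.Sum using (_⊎_; inj₁; inj₂)
open import Data.Empty using (⊥-elim)
open import Relation.Nullary using (yes; no; ¬_)
open import Relation.Nullary.Decidable using (⌊_⌋)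
open import Relation.Binary.Definitions using (DecidableEquality)
open import Relation.Binary.PropositionalEquality using (_≡_; refl; cong)
open import Function.Bundles using (_↔_; Inverse)

-- The vertex set is an arbitrary type V which is finite: it has decidable
-- equality and a list containing every vertex.

record Graph : Set₁ where
  field
    V        : Set
    _≟V_     : DecidableEquality V
    elems    : List V
    complete : ∀ v → v ∈ elems
    E        : V → V → Bool
    E-sym    : ∀ u v → E u v ≡ E v u
    E-irr    : ∀ v → E v v ≡ false

open Graph public

VSet : Graph → Set
VSet G = V G → Bool

IsModule : (G : Graph) → VSet G → Set
IsModule G M =
  ∀ v → T (not (M v)) →
    (∀ x → T (M x) → E G v x ≡ true) ⊎ (∀ x → T (M x) → E G v x ≡ false)

Sub : (A : Set) → (A → Bool) → Set
Sub A M = Σ A (λ v → T (M v))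

sub-list : {A : Set} (M : A → Bool) → List A → List (Sub A M)
sub-list M [] = []
sub-list M (v ∷ l) with T? (M v)
... | yes p = (v , p) ∷ sub-list M l
... | no _  = sub-list M l

sub-complete : {A : Set} (M : A → Bool) (l : List A) (v : A) (p : T (M v)) →
               v ∈ l → (v , p) ∈ sub-list M l
sub-complete M (w ∷ l) v p (here refl) with T? (M v)
... | yes q rewrite T-irrelevant p q = here refl
... | no ¬q = ⊥-elim (¬q p)
sub-complete M (w ∷ l) v p (there v∈l) with T? (M w)
... | yes _ = there (sub-complete M l v p v∈l)
... | no _  = sub-complete M l v p v∈l

sub-≟ : {A : Set} (M : A → Bool) → DecidableEquality A → DecidableEquality (Sub A M)
sub-≟ M _≟_ (u , p) (v , q) with u ≟ v
... | yes refl rewrite T-irrelevant p q = yes refl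
... | no u≢v = no (λ eq → u≢v (cong proj₁ eq))

_[_] : (G : Graph) → VSet G → Graph
G [ M ] = record
  { V        = Sub (V G) M
  ; _≟V_     = sub-≟ M (_≟V_ G)
  ; elems    = sub-list M (elems G)
  ; complete = λ { (v , p) → sub-complete M (elems G) v p (complete G v) }
  ; E        = λ u v → E G (proj₁ u) (proj₁ v)
  ; E-sym    = λ u v → E-sym G (proj₁ u) (proj₁ v)
  ; E-irr    = λ v → E-irr G (proj₁ v)
  }

-- Modular replacement: replace G[M] by H.
-- Vertex set (V ∖ M) ⊎ V_H; u ∈ V ∖ M is joined to every vertex of H
-- iff u ∈ N(M), i.e. u is adjacent to some vertex of M.

inN : (G : Graph) → VSet G → V G → Bool
inN G M u = any (λ w → M w ∧ E G u w) (elems G)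

Outside : (G : Graph) → VSet G → Set
Outside G M = Sub (V G) (λ v → not (M v))

⊎-≟ : {A B : Set} → DecidableEquality A → DecidableEquality B → DecidableEquality (A ⊎ B)
⊎-≟ da db (inj₁ a) (inj₁ a') with da a a'
... | yes refl = yes refl
... | no ne = no (λ { refl → ne refl })
⊎-≟ da db (inj₂ b) (inj₂ b') with db b b'
... | yes refl = yes refl
... | no ne = no (λ { refl → ne refl })
⊎-≟ da db (inj₁ a) (inj₂ b) = no (λ ())
⊎-≟ da db (inj₂ b) (inj₁ a) = no (λ ())

⊎-complete : {A B : Set} (la : List A) (lb : List B) →
             (∀ a → a ∈ la) → (∀ b → b ∈ lb) →
             ∀ x → x ∈ (map inj₁ la ++ map inj₂ lb)
⊎-complete la lb ca cb (inj₁ a) = ∈-++⁺ˡ (∈-map⁺ inj₁ (ca a))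
⊎-complete la lb ca cb (inj₂ b) = ∈-++⁺ʳ (map inj₁ la) (∈-map⁺ inj₂ (cb b))

replE : (G : Graph) (M : VSet G) (H : Graph) →
        Outside G M ⊎ V H → Outside G M ⊎ V H → Bool
replE G M H (inj₁ u) (inj₁ v) = E G (proj₁ u) (proj₁ v)
replE G M H (inj₂ a) (inj₂ b) = E H a b
replE G M H (inj₁ u) (inj₂ b) = inN G M (proj₁ u)
replE G M H (inj₂ a) (inj₁ v) = inN G M (proj₁ v)

replE-sym : (G : Graph) (M : VSet G) (H : Graph) → ∀ x y →
            replE G M H x y ≡ replE G M H y x
replE-sym G M H (inj₁ u) (inj₁ v) = E-sym G (proj₁ u) (proj₁ v)
replE-sym G M H (inj₂ a) (inj₂ b) = E-sym H a b
replE-sym G M H (inj₁ u) (inj₂ b) = refl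
replE-sym G M H (inj₂ a) (inj₁ v) = refl

replE-irr : (G : Graph) (M : VSet G) (H : Graph) → ∀ x → replE G M H x x ≡ false
replE-irr G M H (inj₁ u) = E-irr G (proj₁ u)
replE-irr G M H (inj₂ a) = E-irr H a

replace : (G : Graph) (M : VSet G) (H : Graph) → Graph
replace G M H = record
  { V        = Outside G M ⊎ V H
  ; _≟V_     = ⊎-≟ (sub-≟ (λ v → not (M v)) (_≟V_ G)) (_≟V_ H)
  ; elems    = map inj₁ (sub-list (λ v → not (M v)) (elems G)) ++ map inj₂ (elems H)
  ; complete = ⊎-complete _ _
                 (λ { (v , p) → sub-complete (λ w → not (M w)) (elems G) v p (complete G v) })
                 (complete H)
  ; E        = replE G M H
  ; E-sym    = replE-sym G M H
  ; E-irr    = replE-irr G M H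
  }

record _≅_ (G H : Graph) : Set where
  field
    iso      : V G ↔ V H
    preserve : ∀ u v → E G u v ≡ E H (Inverse.to iso u) (Inverse.to iso v)

record ModularPartition (G : Graph) : Set where
  field
    k        : ℕ
    part     : V G → Fin k
    nonempty : ∀ i → ∃[ v ] part v ≡ i
  cls : Fin k → VSet G
  cls i v = ⌊ part v Fin.≟ i ⌋
  field
    modules  : ∀ i → IsModule G (cls i)

open ModularPartition public

QAdj : (G : Graph) (P : ModularPartition G) → Fin (k P) → Fin (k P) → Set
QAdj G P i j = ∀ u v → T (cls P i u) → T (cls P j v) → E G u v ≡ true

record QuotIso (G₁ : Graph) (P₁ : ModularPartition G₁)
               (G₂ : Graph) (P₂ : ModularPartition G₂) : Set where
  field
    φ   : Fin (k P₁) ↔ Fin (k P₂)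
    adj : ∀ i j → (QAdj G₁ P₁ i j → QAdj G₂ P₂ (Inverse.to φ i) (Inverse.to φ j))
                × (QAdj G₂ P₂ (Inverse.to φ i) (Inverse.to φ j) → QAdj G₁ P₁ i j)

-- Place G₁ and G₂ side by side in one graph B, joining a vertex in part i of
-- G₁ to a vertex in part i' of G₂ exactly when parts i and φ⁻¹(i') are
-- adjacent in G₁/P₁.  Every class of this combined partition is a
-- module of B.  For a set S of parts let B_S be the subgraph of B induced by
-- the G₂-parts indexed by S and the G₁-parts outside S; adding one part j to S
-- changes B_S by a single modular replacement of G₁[M_j] by G₂[M_φ(j)].
-- Sweeping S from ∅ to all parts, one part at a time, transports the values
-- of F from B_∅ ≅ G₁ to B_all ≅ G₂.
module Submission where

open import Defs
open import Data.Nat using (ℕ)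
open import Data.Fin using (Fin)
open import Function.Bundles using (Inverse)
open import Relation.Binary.PropositionalEquality using (_≡_)

open import Data.Bool using (Bool; true; false; T; not; _∧_)
open import Data.Bool.Properties using (T?; T-irrelevant; T-≡; T-not-≡; T-∧; ⇔→≡)
open import Data.Empty using (⊥-elim)
open import Data.Fin using (toℕ; fromℕ<) renaming (_≟_ to _≟ᶠ_)
open import Data.Fin.Properties using (toℕ-fromℕ<; toℕ<n; toℕ-injective)
open import Data.List using (map; _++_)
open import Data.List.Membership.Propositional using (lose)
open import Data.List.Relation.Unary.Any using (satisfied)
open import Data.List.Relation.Unary.Any.Properties using (any⁺; any⁻)
open import Data.Nat using (zero; suc; _<_; _≤_; _<ᵇ_)
open import Data.Nat.Properties using (≤-refl; <⇒≤; <-irrefl; n≮0; n<1+n; m<n⇒m<1+n; ≤∧≢⇒<; <⇒≤pred; <ᵇ⇒<; <⇒<ᵇ)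
open import Data.Product using (∃-syntax; _,_; _×_; proj₁; proj₂)
open import Data.Sum using (_⊎_; inj₁; inj₂)
open import Data.Sum.Properties using (inj₁-injective; inj₂-injective)
open import Data.Unit using (tt)
open import Function.Base using (_∘_)
open import Function.Bundles using (_⇔_; mk⇔; mk↔ₛ′; Equivalence)
open import Relation.Nullary using (yes; no; ¬_)
open import Relation.Nullary.Decidable
  using (⌊_⌋; dec-true; dec-false; does-⇔; fromWitness; toWitness; fromWitnessFalse; toWitnessFalse)
open import Relation.Binary.PropositionalEquality using (_≢_; refl; sym; trans; cong; cong₂; subst; module ≡-Reasoning)

open Equivalence using (to; from)

T-not⇔¬T : ∀ {b} → T (not b) ⇔ (¬ T b)
T-not⇔¬T {false} = mk⇔ (λ _ ()) (λ _ → tt)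
T-not⇔¬T {true}  = mk⇔ (λ ()) (λ ¬t → ¬t tt)

Sub-≡ : {A : Set} {M : A → Bool} {x y : Sub A M} → proj₁ x ≡ proj₁ y → x ≡ y
Sub-≡ {x = a , p} {y = .a , q} refl = cong (a ,_) (T-irrelevant p q)

embedding⇒≅ : (A B : Graph) (Y : VSet B) (e : V A → V B) →
  (∀ {u v} → e u ≡ e v → u ≡ v) →
  (∀ u → T (Y (e u))) →
  (∀ y → T (Y y) → ∃[ u ] e u ≡ y) →
  (∀ u v → E A u v ≡ E B (e u) (e v)) →
  A ≅ (B [ Y ])
embedding⇒≅ A B Y e e-injective e∈Y e-onto e-edges = record
  { iso      = mk↔ₛ′ embed (proj₁ ∘ preimage) embed∘preimage preimage∘embed
  ; preserve = e-edges
  }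
  where
    embed : V A → Sub (V B) Y
    embed u = e u , e∈Y u

    preimage : (y : Sub (V B) Y) → ∃[ u ] e u ≡ proj₁ y
    preimage (y , y∈Y) = e-onto y y∈Y

    embed∘preimage : ∀ y → embed (proj₁ (preimage y)) ≡ y
    embed∘preimage y = Sub-≡ (proj₂ (preimage y))

    preimage∘embed : ∀ u → proj₁ (preimage (embed u)) ≡ u
    preimage∘embed u = e-injective (proj₂ (preimage (embed u)))

IsModule⇒uniform : (G : Graph) (M : VSet G) → IsModule G M →
  ∀ {v x y} → T (not (M v)) → T (M x) → T (M y) → E G v x ≡ E G v y
IsModule⇒uniform G M M-module {v} {x} {y} v∉M x∈M y∈M with M-module v v∉M
... | inj₁ all  = trans (all x x∈M) (sym (all y y∈M))
... | inj₂ none = trans (none x x∈M) (sym (none y y∈M))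

uniform⇒IsModule : (G : Graph) (M : VSet G) (c : V G → Bool) →
  (∀ {v x} → T (not (M v)) → T (M x) → E G v x ≡ c v) → IsModule G M
uniform⇒IsModule G M c uniform v v∉M with c v in cv
... | true  = inj₁ (λ x x∈M → trans (uniform v∉M x∈M) cv)
... | false = inj₂ (λ x x∈M → trans (uniform v∉M x∈M) cv)

IsModule-restrict : (G : Graph) (M X : VSet G) → IsModule G M → IsModule (G [ X ]) (M ∘ proj₁)
IsModule-restrict G M X M-module (v , _) v∉M with M-module v v∉M
... | inj₁ all  = inj₁ (λ x → all (proj₁ x))
... | inj₂ none = inj₂ (λ x → none (proj₁ x))

inN-module : (G : Graph) (M : VSet G) → IsModule G M →
  ∀ {m u} → T (M m) → T (not (M u)) → inN G M u ≡ E G u m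
inN-module G M M-module {m} {u} m∈M u∉M = ⇔→≡ (mk⇔ inN⇒edge edge⇒inN)
  where
    inN⇒edge : inN G M u ≡ true → E G u m ≡ true
    inN⇒edge eq with satisfied (any⁻ (λ w → M w ∧ E G u w) (elems G) (from T-≡ eq))
    ... | w , w∈M∧uw = trans (IsModule⇒uniform G M M-module u∉M m∈M (proj₁ (to T-∧ w∈M∧uw)))
                             (to T-≡ (proj₂ (to T-∧ w∈M∧uw)))

    edge⇒inN : E G u m ≡ true → inN G M u ≡ true
    edge⇒inN eq = to T-≡ (any⁺ (λ w → M w ∧ E G u w)
                           (lose (complete G m) (from T-∧ (m∈M , from T-≡ eq))))

-- The edges from the new part are read off the vertex m of X ∩ M, which is why
-- X must meet M.
swap-≅ : (B : Graph) (M : VSet B) → IsModule B M → (X X' : VSet B) →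
  (∀ x → T (not (M x)) → X x ≡ X' x) →
  ∀ {m} → T (X m) → T (M m) →
  replace (B [ X ]) (M ∘ proj₁) (B [ (λ x → X' x ∧ M x) ]) ≅ (B [ X' ])
swap-≅ B M M-module X X' agree {m} m∈X m∈M =
  embedding⇒≅ _ B X' forget forget-injective forget∈X' forget-onto forget-edges
  where
    A : Graph
    A = replace (B [ X ]) (M ∘ proj₁) (B [ (λ x → X' x ∧ M x) ])

    forget : V A → V B
    forget (inj₁ ((x , _) , _)) = x
    forget (inj₂ (x , _))       = x

    forget-injective : ∀ {a b} → forget a ≡ forget b → a ≡ b
    forget-injective {inj₁ _} {inj₁ _} eq = cong inj₁ (Sub-≡ (Sub-≡ eq))
    forget-injective {inj₂ _} {inj₂ _} eq = cong inj₂ (Sub-≡ eq)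
    forget-injective {inj₁ (_ , x∉M)} {inj₂ (_ , y∈X'∩M)} refl =
      ⊥-elim (to T-not⇔¬T x∉M (proj₂ (to T-∧ y∈X'∩M)))
    forget-injective {inj₂ (_ , x∈X'∩M)} {inj₁ (_ , y∉M)} refl =
      ⊥-elim (to T-not⇔¬T y∉M (proj₂ (to T-∧ x∈X'∩M)))

    forget∈X' : ∀ a → T (X' (forget a))
    forget∈X' (inj₁ ((_ , x∈X) , x∉M)) = subst T (agree _ x∉M) x∈X
    forget∈X' (inj₂ (_ , x∈X'∩M))      = proj₁ (to T-∧ x∈X'∩M)

    forget-onto : ∀ y → T (X' y) → ∃[ a ] forget a ≡ y
    forget-onto y y∈X' with T? (M y)
    ... | yes y∈M = inj₂ (y , from T-∧ (y∈X' , y∈M)) , refl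
    ... | no ¬y∈M = inj₁ ((y , subst T (sym (agree y y∉M)) y∈X') , y∉M) , refl
      where y∉M = from T-not⇔¬T ¬y∈M

    cross-edge : ∀ {x y} (x∈X : T (X x)) → T (not (M x)) → T (M y) →
      inN (B [ X ]) (M ∘ proj₁) (x , x∈X) ≡ E B x y
    cross-edge {x} x∈X x∉M y∈M =
      trans (inN-module (B [ X ]) (M ∘ proj₁) (IsModule-restrict B M X M-module)
                        {m , m∈X} {x , x∈X} m∈M x∉M)
            (IsModule⇒uniform B M M-module x∉M m∈M y∈M)

    forget-edges : ∀ a b → E A a b ≡ E B (forget a) (forget b)
    forget-edges (inj₁ _) (inj₁ _) = refl
    forget-edges (inj₂ _) (inj₂ _) = refl
    forget-edges (inj₁ ((x , x∈X) , x∉M)) (inj₂ (y , y∈X'∩M)) =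
      cross-edge x∈X x∉M (proj₂ (to T-∧ y∈X'∩M))
    forget-edges (inj₂ (y , y∈X'∩M)) (inj₁ ((x , x∈X) , x∉M)) =
      trans (cross-edge x∈X x∉M (proj₂ (to T-∧ y∈X'∩M))) (E-sym B x y)

module QuotientEdges (G : Graph) (P : ModularPartition G) where

  representative : Fin (k P) → V G
  representative i = proj₁ (nonempty P i)

  representative∈ : ∀ i → T (cls P i (representative i))
  representative∈ i = fromWitness (proj₂ (nonempty P i))

  quotientEdge : Fin (k P) → Fin (k P) → Bool
  quotientEdge i j = E G (representative i) (representative j)

  cls-disjoint : ∀ {i j w} → i ≢ j → T (cls P i w) → T (not (cls P j w))
  cls-disjoint i≢j w∈i = fromWitnessFalse (λ w∈j → i≢j (trans (sym (toWitness w∈i)) w∈j))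

  E≡quotientEdge : ∀ {i j u v} → i ≢ j → T (cls P i u) → T (cls P j v) →
    E G u v ≡ quotientEdge i j
  E≡quotientEdge {i} {j} {u} {v} i≢j u∈i v∈j = begin
    E G u v                ≡⟨ IsModule⇒uniform G (cls P j) (modules P j)
                                (cls-disjoint i≢j u∈i) v∈j (representative∈ j) ⟩
    E G u rep-j            ≡⟨ E-sym G u rep-j ⟩
    E G rep-j u            ≡⟨ IsModule⇒uniform G (cls P i) (modules P i)
                                (cls-disjoint (i≢j ∘ sym) (representative∈ j)) u∈i (representative∈ i) ⟩
    E G rep-j rep-i        ≡⟨ E-sym G rep-j rep-i ⟩
    quotientEdge i j       ∎
    where
      open ≡-Reasoning
      rep-i = representative i
      rep-j = representative j

  E≡quotientEdge-part : ∀ u v → part P u ≢ part P v →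
    E G u v ≡ quotientEdge (part P u) (part P v)
  E≡quotientEdge-part u v ne = E≡quotientEdge ne (fromWitness refl) (fromWitness refl)

  QAdj⇔quotientEdge : ∀ {i j} → i ≢ j → QAdj G P i j ⇔ (quotientEdge i j ≡ true)
  QAdj⇔quotientEdge {i} {j} i≢j = mk⇔
    (λ adj → adj _ _ (representative∈ i) (representative∈ j))
    (λ eq u v u∈i v∈j → trans (E≡quotientEdge i≢j u∈i v∈j) eq)

module Blend (G₁ G₂ : Graph) (P₁ : ModularPartition G₁) (P₂ : ModularPartition G₂)
             (ψ : QuotIso G₁ P₁ G₂ P₂) where

  open QuotientEdges G₁ P₁ using (representative∈)
    renaming (representative to representative₁; quotientEdge to quotientEdge₁;
              E≡quotientEdge-part to E≡quotientEdge₁; QAdj⇔quotientEdge to QAdj⇔quotientEdge₁)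
  open QuotientEdges G₂ P₂ using ()
    renaming (quotientEdge to quotientEdge₂;
              E≡quotientEdge-part to E≡quotientEdge₂; QAdj⇔quotientEdge to QAdj⇔quotientEdge₂)

  K : ℕ
  K = k P₁

  φ : Fin K → Fin (k P₂)
  φ = Inverse.to (QuotIso.φ ψ)

  φ⁻¹ : Fin (k P₂) → Fin K
  φ⁻¹ = Inverse.from (QuotIso.φ ψ)

  φ⁻¹∘φ : ∀ i → φ⁻¹ (φ i) ≡ i
  φ⁻¹∘φ = Inverse.strictlyInverseʳ (QuotIso.φ ψ)

  φ∘φ⁻¹ : ∀ i → φ (φ⁻¹ i) ≡ i
  φ∘φ⁻¹ = Inverse.strictlyInverseˡ (QuotIso.φ ψ)

  quotientEdge-φ : ∀ {i j} → i ≢ j → quotientEdge₁ i j ≡ quotientEdge₂ (φ i) (φ j)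
  quotientEdge-φ {i} {j} i≢j = ⇔→≡ (mk⇔
    (to (QAdj⇔quotientEdge₂ φi≢φj) ∘ proj₁ (QuotIso.adj ψ i j) ∘ from (QAdj⇔quotientEdge₁ i≢j))
    (to (QAdj⇔quotientEdge₁ i≢j) ∘ proj₂ (QuotIso.adj ψ i j) ∘ from (QAdj⇔quotientEdge₂ φi≢φj)))
    where
      φi≢φj : φ i ≢ φ j
      φi≢φj eq = i≢j (trans (sym (φ⁻¹∘φ i)) (trans (cong φ⁻¹ eq) (φ⁻¹∘φ j)))

  blendPart : V G₁ ⊎ V G₂ → Fin K
  blendPart (inj₁ v) = part P₁ v
  blendPart (inj₂ w) = φ⁻¹ (part P₂ w)

  blendE : V G₁ ⊎ V G₂ → V G₁ ⊎ V G₂ → Bool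
  blendE (inj₁ u) (inj₁ v) = E G₁ u v
  blendE (inj₂ a) (inj₂ b) = E G₂ a b
  blendE x        y        = quotientEdge₁ (blendPart x) (blendPart y)

  blendE-sym : ∀ x y → blendE x y ≡ blendE y x
  blendE-sym (inj₁ u) (inj₁ v) = E-sym G₁ u v
  blendE-sym (inj₂ a) (inj₂ b) = E-sym G₂ a b
  blendE-sym (inj₁ u) (inj₂ b) = E-sym G₁ _ _
  blendE-sym (inj₂ a) (inj₁ v) = E-sym G₁ _ _

  blendE-irr : ∀ x → blendE x x ≡ false
  blendE-irr (inj₁ v) = E-irr G₁ v
  blendE-irr (inj₂ w) = E-irr G₂ w

  blend : Graph
  blend = record
    { V        = V G₁ ⊎ V G₂
    ; _≟V_     = ⊎-≟ (_≟V_ G₁) (_≟V_ G₂)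
    ; elems    = map inj₁ (elems G₁) ++ map inj₂ (elems G₂)
    ; complete = ⊎-complete _ _ (complete G₁) (complete G₂)
    ; E        = blendE
    ; E-sym    = blendE-sym
    ; E-irr    = blendE-irr
    }

  blendE≡quotientEdge : ∀ x y → blendPart x ≢ blendPart y →
    blendE x y ≡ quotientEdge₁ (blendPart x) (blendPart y)
  blendE≡quotientEdge (inj₁ u) (inj₁ v) ne = E≡quotientEdge₁ u v ne
  blendE≡quotientEdge (inj₂ a) (inj₂ b) ne = begin
    E G₂ a b                                       ≡⟨ E≡quotientEdge₂ a b (ne ∘ cong φ⁻¹) ⟩
    quotientEdge₂ (part P₂ a) (part P₂ b)          ≡⟨ cong₂ quotientEdge₂ (φ∘φ⁻¹ _) (φ∘φ⁻¹ _) ⟨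
    quotientEdge₂ (φ (φ⁻¹ (part P₂ a))) (φ (φ⁻¹ (part P₂ b))) ≡⟨ quotientEdge-φ ne ⟨
    quotientEdge₁ (φ⁻¹ (part P₂ a)) (φ⁻¹ (part P₂ b)) ∎
    where open ≡-Reasoning
  blendE≡quotientEdge (inj₁ _) (inj₂ _) _ = refl
  blendE≡quotientEdge (inj₂ _) (inj₁ _) _ = refl

  blendClass : Fin K → VSet blend
  blendClass j x = ⌊ blendPart x ≟ᶠ j ⌋

  blendClass-module : ∀ j → IsModule blend (blendClass j)
  blendClass-module j = uniform⇒IsModule blend (blendClass j) (λ x → quotientEdge₁ (blendPart x) j)
    λ {x} {y} x∉j y∈j →
      trans (blendE≡quotientEdge x y (λ eq → toWitnessFalse x∉j (trans eq (toWitness y∈j))))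
            (cong (quotientEdge₁ (blendPart x)) (toWitness y∈j))

  select : (Fin K → Bool) → VSet blend
  select S (inj₁ v) = not (S (part P₁ v))
  select S (inj₂ w) = S (blendPart (inj₂ w))

  select-agree : ∀ {S S' j} → (∀ {i} → i ≢ j → S i ≡ S' i) →
    ∀ x → T (not (blendClass j x)) → select S x ≡ select S' x
  select-agree agree (inj₁ v) v∉j = cong not (agree (toWitnessFalse v∉j))
  select-agree agree (inj₂ w) w∉j = agree (toWitnessFalse w∉j)

  representative-selected : ∀ {S j} → S j ≡ false → T (select S (inj₁ (representative₁ j)))
  representative-selected {S} {j} Sj = from T-not-≡ (trans (cong S (toWitness (representative∈ j))) Sj)

  G₁≅blend : ∀ S → (∀ i → S i ≡ false) → G₁ ≅ (blend [ select S ])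
  G₁≅blend S none = embedding⇒≅ G₁ blend (select S) inj₁ inj₁-injective
    (λ v → from T-not-≡ (none (part P₁ v))) onto (λ _ _ → refl)
    where
      onto : ∀ x → T (select S x) → ∃[ v ] inj₁ v ≡ x
      onto (inj₁ v) _ = v , refl
      onto (inj₂ w) w∈S = ⊥-elim (subst T (none _) w∈S)

  G₂≅blend : ∀ S → (∀ i → S i ≡ true) → G₂ ≅ (blend [ select S ])
  G₂≅blend S all = embedding⇒≅ G₂ blend (select S) inj₂ inj₂-injective
    (λ w → from T-≡ (all _)) onto (λ _ _ → refl)
    where
      onto : ∀ x → T (select S x) → ∃[ w ] inj₂ w ≡ x
      onto (inj₁ v) v∉S = ⊥-elim (subst (T ∘ not) (all _) v∉S)
      onto (inj₂ w) _ = w , refl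

  part₁≅ : ∀ {S j} → S j ≡ false →
    (G₁ [ cls P₁ j ]) ≅ ((blend [ select S ]) [ blendClass j ∘ proj₁ ])
  part₁≅ {S} {j} Sj = embedding⇒≅ (G₁ [ cls P₁ j ]) (blend [ select S ]) (blendClass j ∘ proj₁)
    embed (λ eq → Sub-≡ (inj₁-injective (cong proj₁ eq))) proj₂ onto (λ _ _ → refl)
    where
      S-off : ∀ {x} → T (blendClass j x) → S (blendPart x) ≡ false
      S-off x∈j = trans (cong S (toWitness x∈j)) Sj

      embed : V (G₁ [ cls P₁ j ]) → V (blend [ select S ])
      embed (v , v∈j) = inj₁ v , from T-not-≡ (S-off {inj₁ v} v∈j)

      onto : ∀ x → T (blendClass j (proj₁ x)) → ∃[ u ] embed u ≡ x
      onto (inj₁ v , _) v∈j = (v , v∈j) , Sub-≡ refl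
      onto (inj₂ w , w∈S) w∈j = ⊥-elim (subst T (S-off {inj₂ w} w∈j) w∈S)

  part₂≅ : ∀ {S j} → S j ≡ true →
    (G₂ [ cls P₂ (φ j) ]) ≅ (blend [ (λ x → select S x ∧ blendClass j x) ])
  part₂≅ {S} {j} Sj = embedding⇒≅ (G₂ [ cls P₂ (φ j) ]) blend _
    (inj₂ ∘ proj₁) (Sub-≡ ∘ inj₂-injective) embed∈ onto (λ _ _ → refl)
    where
      S-on : ∀ {x} → blendPart x ≡ j → S (blendPart x) ≡ true
      S-on eq = trans (cong S eq) Sj

      embed∈ : ∀ u → T (select S (inj₂ (proj₁ u)) ∧ blendClass j (inj₂ (proj₁ u)))
      embed∈ (w , w∈φj) = from T-∧ (from T-≡ (S-on {inj₂ w} inj₂∈j) , fromWitness inj₂∈j)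
        where inj₂∈j = trans (cong φ⁻¹ (toWitness w∈φj)) (φ⁻¹∘φ j)

      selected-in-j : ∀ x → T (select S x ∧ blendClass j x) → T (select S x) × blendPart x ≡ j
      selected-in-j x x∈X∩j with to (T-∧ {select S x} {blendClass j x}) x∈X∩j
      ... | x∈X , x∈j = x∈X , toWitness x∈j

      onto : ∀ x → T (select S x ∧ blendClass j x) → ∃[ u ] inj₂ (proj₁ u) ≡ x
      onto (inj₁ v) v∈X∩j with selected-in-j (inj₁ v) v∈X∩j
      ... | v∉S , v∈j = ⊥-elim (subst (T ∘ not) (S-on {inj₁ v} v∈j) v∉S)
      onto (inj₂ w) w∈X∩j with selected-in-j (inj₂ w) w∈X∩j
      ... | _ , w∈j = (w , fromWitness (trans (sym (φ∘φ⁻¹ _)) (cong φ w∈j))) , refl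

prefix : ℕ → ∀ {n} → Fin n → Bool
prefix t i = toℕ i <ᵇ t

prefix-zero : ∀ {n} (i : Fin n) → prefix 0 i ≡ false
prefix-zero i = dec-false (T? _) (n≮0 ∘ <ᵇ⇒< (toℕ i) 0)

prefix-all : ∀ {n} (i : Fin n) → prefix n i ≡ true
prefix-all i = dec-true (T? _) (<⇒<ᵇ (toℕ<n i))

module _ {n t} (t<n : t < n) where

  prefix-at : prefix t (fromℕ< t<n) ≡ false
  prefix-at = dec-false (T? _) (<-irrefl (toℕ-fromℕ< t<n) ∘ <ᵇ⇒< _ t)

  prefix-suc-at : prefix (suc t) (fromℕ< t<n) ≡ true
  prefix-suc-at = dec-true (T? _) (<⇒<ᵇ (subst (_< suc t) (sym (toℕ-fromℕ< t<n)) (n<1+n t)))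

  prefix-suc : ∀ {i} → i ≢ fromℕ< t<n → prefix t i ≡ prefix (suc t) i
  prefix-suc {i} i≢t = does-⇔ (mk⇔ (<⇒<ᵇ ∘ m<n⇒m<1+n ∘ <ᵇ⇒< _ t) (<⇒<ᵇ ∘ below-t ∘ <ᵇ⇒< _ (suc t)))
                               (T? _) (T? _)
    where
      below-t : toℕ i < suc t → toℕ i < t
      below-t lt = ≤∧≢⇒< (<⇒≤pred lt) (λ eq → i≢t (toℕ-injective (trans eq (sym (toℕ-fromℕ< t<n)))))

module _ {r : ℕ} (F : Fin r → Graph → ℕ)
         (F-iso : ∀ i G H → G ≅ H → F i G ≡ F i H)
         (F-replace : ∀ (G H : Graph) (M : VSet G) → IsModule G M →
                        (∀ i → F i (G [ M ]) ≡ F i H) →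
                        ∀ i → F i G ≡ F i (replace G M H)) where

  F-swap : (B : Graph) (M : VSet B) → IsModule B M → (X X' : VSet B) →
    (∀ x → T (not (M x)) → X x ≡ X' x) →
    ∀ {m} → T (X m) → T (M m) →
    (∀ i → F i ((B [ X ]) [ M ∘ proj₁ ]) ≡ F i (B [ (λ x → X' x ∧ M x) ])) →
    ∀ i → F i (B [ X ]) ≡ F i (B [ X' ])
  F-swap B M M-module X X' agree m∈X m∈M same-part i =
    trans (F-replace _ _ _ (IsModule-restrict B M X M-module) same-part i)
          (F-iso i _ _ (swap-≅ B M M-module X X' agree m∈X m∈M))

lemma1 : (r : ℕ) (F : Fin r → Graph → ℕ) →
    (∀ i G H → G ≅ H → F i G ≡ F i H) →
    (∀ (G H : Graph) (M : VSet G) → IsModule G M →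
    (∀ i → F i (G [ M ]) ≡ F i H) →
    ∀ i → F i G ≡ F i (replace G M H)) →
    ∀ (G₁ G₂ : Graph) (P₁ : ModularPartition G₁) (P₂ : ModularPartition G₂)
    (ψ : QuotIso G₁ P₁ G₂ P₂) →
    (∀ j i → F i (G₁ [ cls P₁ j ]) ≡ F i (G₂ [ cls P₂ (Inverse.to (QuotIso.φ ψ) j) ])) →
    ∀ i → F i G₁ ≡ F i G₂
lemma1 r F F-iso F-replace G₁ G₂ P₁ P₂ ψ same-parts i = begin
  F i G₁                             ≡⟨ F-iso i _ _ (G₁≅blend (prefix 0) prefix-zero) ⟩
  F i (blend [ select (prefix 0) ])  ≡⟨ sweep K ≤-refl ⟩
  F i (blend [ select (prefix K) ])  ≡⟨ F-iso i _ _ (G₂≅blend (prefix K) prefix-all) ⟨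
  F i G₂                             ∎
  where
    open ≡-Reasoning
    open Blend G₁ G₂ P₁ P₂ ψ
    open QuotientEdges G₁ P₁ using (representative; representative∈)

    flip-part : ∀ {S S' j} → S j ≡ false → S' j ≡ true → (∀ {i} → i ≢ j → S i ≡ S' i) →
      ∀ i → F i (blend [ select S ]) ≡ F i (blend [ select S' ])
    flip-part {S} {S'} {j} Sj S'j agree =
      F-swap F F-iso F-replace blend (blendClass j) (blendClass-module j) (select S) (select S')
        (select-agree agree) {inj₁ (representative j)}
        (representative-selected {S} Sj) (representative∈ j)
        (λ i → trans (sym (F-iso i _ _ (part₁≅ Sj)))
                     (trans (same-parts j i) (F-iso i _ _ (part₂≅ S'j))))

    sweep : ∀ t → t ≤ K → F i (blend [ select (prefix 0) ]) ≡ F i (blend [ select (prefix t) ])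
    sweep zero    _   = refl
    sweep (suc t) t<K = trans (sweep t (<⇒≤ t<K))
      (flip-part (prefix-at t<K) (prefix-suc-at t<K) (prefix-suc t<K) i)
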